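{- Let $\mathcal G$ be a connected hypergraph and $\alpha$ a vertex of $\mathcal G$. Let $\mathcal G'$ be an $\alpha$-detachment of $\mathcal G$ obtained by splitting $\alpha$ into two vertices $\alpha$ and $\beta$. Then $\mathcal G'$ is connected if and only if there exists an $\alpha$-wing $W$ of $\mathcal G$ with $d_W(\alpha)\ge 2$ such that $$1\le |H_W(\alpha)\cap H_{\mathcal G'}(\beta)|<d_W(\alpha).$$
   Context: A hypergraph is a pair $(V,E)$, $V$ finite, $E$ a multiset of edges, each edge a multi-subset of $V$ (vertices may occur several times in an edge; each copy of an edge is a distinct edge). The degree $d_{\mathcal G}(v)$ is the total number of occurrences of $v$ among all edges. A hypergraph is non-trivial if it has at least one edge; connected means any two vertices are joined by a sequence of vertices with consecutive ones in a common edge. Hinges: if vertex $\alpha$ occurs with multiplicity $p$ in edge $e$, we associate to this $p$ distinct objects $h_1(\alpha,e),\dots,h_p(\alpha,e)$ called hinges, incident with $\alpha$ and with $e$; $H_{\mathcal G}(\alpha)$ is the set of all hinges incident with $\alpha$, so $|H_{\mathcal G}(\alpha)|=d_{\mathcal G}(\alpha)$; for a sub-hypergraph $W$, $H_W(\alpha)$ is the set of hinges at $\alpha$ of edges of $W$ and $d_W(\alpha)=|H_W(\alpha)|$. A vertex $\alpha$ of a connected hypergraph $\mathcal G$ is a cut vertex if there are non-trivial sub-hypergraphs $I,J$ with $I\cup J=\mathcal G$, $V(I\cap J)=\{\alpha\}$ and $E(I\cap J)=\varnothing$. An $\alpha$-wing of a connected hypergraph $\mathcal G$ is a non-trivial connected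 sub-hypergraph $W$ of $\mathcal G$ such that $\alpha$ is not a cut vertex of $W$ and no edge in $E(\mathcal G)\setminus E(W)$ is incident with a vertex of $V(W)\setminus\{\alpha\}$. An $\alpha$-detachment splitting $\alpha$ into $\alpha$ and $\beta$ is a hypergraph $\mathcal G'$ on $V\cup\{\beta\}$ ($\beta$ new) with the same edges and hinges, obtained by choosing a subset of $H_{\mathcal G}(\alpha)$ to become incident with $\beta$ instead of $\alpha$: an edge $\{\alpha^p,u_1,\dots,u_z\}$ becomes $\{\alpha^{p-i},\beta^i,u_1,\dots,u_z\}$ where $i$ is the number of its hinges at $\alpha$ that were moved; $H_{\mathcal G'}(\beta)$ is the set of moved hinges. -}

module Defs where

open import Data.Nat using (ℕ; zero; suc; _+_; _∸_; _≤_; _<_)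
open import Data.Fin using (Fin; zero; suc; _≟_)
open import Data.Bool using (Bool; true; false; if_then_else_; _∧_; _∨_)
open import Data.Product using (Σ; ∃; _×_)
open import Relation.Nullary using (¬_; does)
open import Relation.Binary.PropositionalEquality using (_≡_; _≢_)

∑ : {m : ℕ} → (Fin m → ℕ) → ℕ
∑ {zero}  f = 0
∑ {suc m} f = f zero + ∑ {m} (λ i → f (suc i))

count : {k : ℕ} → (Fin k → Bool) → ℕ
count p = ∑ (λ i → if p i then 1 else 0)

-- A hypergraph: vertices Fin nV, edges indexed by Fin nE (a multiset of
-- edges), mult e v = multiplicity of vertex v in edge e.
-- The hinges at v in e are identified with Fin (mult e v).
record Hypergraph : Set where
  field
    nV   : ℕ
    nE   : ℕ
    mult : Fin nE → Fin nV → ℕ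
open Hypergraph public

data PathIn (G : Hypergraph) (es : Fin (nE G) → Bool) : Fin (nV G) → Fin (nV G) → Set where
  here : ∀ {u} → PathIn G es u u
  step : ∀ {u w v} (e : Fin (nE G)) → es e ≡ true →
         0 < mult G e u → 0 < mult G e w → PathIn G es w v → PathIn G es u v

Connected : Hypergraph → Set
Connected G = ∀ (u v : Fin (nV G)) → PathIn G (λ _ → true) u v

record Sub (G : Hypergraph) : Set where
  field
    vs     : Fin (nV G) → Bool
    es     : Fin (nE G) → Bool
    closed : ∀ e v → es e ≡ true → 0 < mult G e v → vs v ≡ true
open Sub public

NonTrivial : {G : Hypergraph} → Sub G → Set
NonTrivial W = ∃ λ e → es W e ≡ true

ConnectedSub : {G : Hypergraph} → Sub G → Set
ConnectedSub {G} W = ∀ u v → vs W u ≡ true → vs W v ≡ true → PathIn G (es W) u v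

CutVertex : {G : Hypergraph} → Fin (nV G) → Sub G → Set
CutVertex {G} α W = Σ (Sub G) λ I → Σ (Sub G) λ J →
  NonTrivial I × NonTrivial J ×
  (∀ v → (vs I v ∨ vs J v) ≡ vs W v) ×
  (∀ e → (es I e ∨ es J e) ≡ es W e) ×
  (∀ v → (vs I v ∧ vs J v) ≡ does (v ≟ α)) ×
  (∀ e → (es I e ∧ es J e) ≡ false)

-- α-wing of G (G assumed connected where used).
Wing : (G : Hypergraph) → Fin (nV G) → Sub G → Set
Wing G α W =
  NonTrivial W × ConnectedSub W × ¬ CutVertex α W ×
  (∀ e v → es W e ≡ false → vs W v ≡ true → v ≢ α → mult G e v ≡ 0)

degSub : {G : Hypergraph} → Sub G → Fin (nV G) → ℕ
degSub {G} W α = ∑ (λ e → if es W e then mult G e α else 0)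

-- A choice of hinges at α to move to β: for each edge e, a subset of
-- the mult e α hinges of e at α.
Moved : (G : Hypergraph) → Fin (nV G) → Set
Moved G α = (e : Fin (nE G)) → Fin (mult G e α) → Bool

-- The α-detachment: vertex set Fin (suc nV); β is zero, each old vertex u
-- becomes suc u (so α becomes suc α).
detach : (G : Hypergraph) (α : Fin (nV G)) → Moved G α → Hypergraph
detach G α S = record
  { nV = suc (nV G)
  ; nE = nE G
  ; mult = m'
  }
  where
  m' : Fin (nE G) → Fin (suc (nV G)) → ℕ
  m' e zero    = count (S e)
  m' e (suc u) = if does (u ≟ α) then mult G e α ∸ count (S e) else mult G e u

movedIn : {G : Hypergraph} {α : Fin (nV G)} → Sub G → Moved G α → ℕ
movedIn W S = ∑ (λ e → if es W e then count (S e) else 0)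

module Submission where

-- (⇐) If α is not a cut vertex of W and W has an edge with a moved hinge and
-- an edge with a kept hinge at α, then β is reachable from α in G' inside W:
-- otherwise the edges of W meeting the component of α, and the others, cut W
-- at α (module Separation).  Lifting paths of G then shows G' is connected.
-- (⇒) A path from β to α in G' exhibits an edge with a moved hinge that is
-- linked, avoiding α, to an edge with a kept hinge (crossing).  The α-wing
-- generated by the first edge (module WingThrough) contains both, which
-- yields the two inequalities (and hence d_W(α) ≥ 2).

open import Defs
open import Data.Nat using (ℕ; zero; suc; _≤_; _<_; z≤n; s≤s)
open import Data.Nat.Properties
  using (≤-trans; ≤-refl; ≤-reflexive; +-mono-≤; +-mono-<-≤; +-mono-≤-<; m≤m+n; m≤n+m; n≤1+n;
         1+n≰n; <⇒≱; ≮⇒≥; _<?_; <-≤-trans; m<n⇒0<n∸m; m∸n≢0⇒n<m; n>0⇒n≢0)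
open import Data.Fin using (Fin; zero; suc; _≟_)
open import Data.Bool using (Bool; true; false; if_then_else_; _∧_; _∨_; not)
open import Data.Bool.Properties using (∨-comm; ∧-comm; ¬-not)
open import Data.Product using (Σ; ∃; ∃₂; _×_; _,_; proj₂)
open import Data.Sum using (_⊎_; inj₁; inj₂)
open import Data.Empty using (⊥; ⊥-elim)
open import Data.Unit using (⊤; tt)
open import Function.Bundles using (_⇔_; mk⇔)
open import Relation.Nullary using (¬_; does; yes; no)
open import Relation.Nullary.Decidable using (dec-true; dec-false)
open import Relation.Binary.PropositionalEquality using (_≡_; _≢_; refl; sym; trans; cong; subst)

false≢true : false ≢ true
false≢true ()

∨-inl : ∀ {a} b → a ≡ true → a ∨ b ≡ true
∨-inl b refl = refl

∨-inr : ∀ a {b} → b ≡ true → a ∨ b ≡ true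
∨-inr true  _ = refl
∨-inr false h = h

∨-elim : ∀ a b → a ∨ b ≡ true → a ≡ true ⊎ b ≡ true
∨-elim true  _ _ = inj₁ refl
∨-elim false _ h = inj₂ h

∧-intro : ∀ {a b} → a ≡ true → b ≡ true → a ∧ b ≡ true
∧-intro refl refl = refl

∧-elim : ∀ a b → a ∧ b ≡ true → a ≡ true × b ≡ true
∧-elim true true _ = refl , refl

not-true : ∀ {a} → not a ≡ true → a ≡ false
not-true {false} _ = refl

isPos : ℕ → Bool
isPos zero    = false
isPos (suc _) = true

isPos-sound : ∀ {n} → isPos n ≡ true → 0 < n
isPos-sound {suc _} _ = s≤s z≤n

isPos-complete : ∀ {n} → 0 < n → isPos n ≡ true
isPos-complete {suc _} _ = refl

guard-true : ∀ {b} {m n : ℕ} → b ≡ true → (if b then m else n) ≡ m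
guard-true refl = refl

guard-pos : ∀ b {n} → 0 < (if b then n else 0) → b ≡ true × 0 < n
guard-pos true p = refl , p

guard-< : ∀ b {m n} → (if b then m else 0) < (if b then n else 0) → b ≡ true × m < n
guard-< true p = refl , p

guard-<-intro : ∀ {b m n} → b ≡ true → m < n → (if b then m else 0) < (if b then n else 0)
guard-<-intro refl p = p

guard-≤ : ∀ b {m n} → m ≤ n → (if b then m else 0) ≤ (if b then n else 0)
guard-≤ true  p = p
guard-≤ false _ = z≤n

∑-term : ∀ {m} (f : Fin m → ℕ) (i : Fin m) → f i ≤ ∑ f
∑-term f zero            = m≤m+n (f zero) _
∑-term {suc m} f (suc i) = ≤-trans (∑-term (λ j → f (suc j)) i) (m≤n+m _ (f zero))

∑-mono : ∀ {m} {f g : Fin m → ℕ} → (∀ i → f i ≤ g i) → ∑ f ≤ ∑ g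
∑-mono {zero}  _ = z≤n
∑-mono {suc m} h = +-mono-≤ (h zero) (∑-mono (λ i → h (suc i)))

∑-mono-< : ∀ {m} {f g : Fin m → ℕ} → (∀ i → f i ≤ g i) → (j : Fin m) → f j < g j → ∑ f < ∑ g
∑-mono-< {suc m} h zero    lt = +-mono-<-≤ lt (∑-mono (λ i → h (suc i)))
∑-mono-< {suc m} h (suc j) lt = +-mono-≤-< (h zero) (∑-mono-< (λ i → h (suc i)) j lt)

∑-<-witness : ∀ {m} (f g : Fin m → ℕ) → ∑ f < ∑ g → ∃ λ i → f i < g i
∑-<-witness {suc m} f g lt with f zero <? g zero
... | yes p = zero , p
... | no ¬p with ∑ (λ i → f (suc i)) <? ∑ (λ i → g (suc i))
...   | yes q = let (i , r) = ∑-<-witness (λ i → f (suc i)) (λ i → g (suc i)) q in suc i , r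
...   | no ¬q = ⊥-elim (<⇒≱ lt (+-mono-≤ (≮⇒≥ ¬p) (≮⇒≥ ¬q)))

∑-pos-witness : ∀ {m} (f : Fin m → ℕ) → 0 < ∑ f → ∃ λ i → 0 < f i
∑-pos-witness {zero} f ()
∑-pos-witness {suc m} f lt with f zero in eq
... | zero  = let (i , r) = ∑-pos-witness (λ i → f (suc i)) lt in suc i , r
... | suc _ = zero , subst (0 <_) (sym eq) (s≤s z≤n)

count-≤ : ∀ {k} (p : Fin k → Bool) → count p ≤ k
count-≤ {zero}  _ = z≤n
count-≤ {suc k} p with p zero
... | true  = s≤s (count-≤ (λ i → p (suc i)))
... | false = ≤-trans (count-≤ (λ i → p (suc i))) (n≤1+n _)

count-pos : ∀ {k} (p : Fin k → Bool) i → p i ≡ true → 1 ≤ count p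
count-pos p i h = ≤-trans (≤-reflexive (sym (guard-true h))) (∑-term (λ j → if p j then 1 else 0) i)

count-strict : ∀ {k} {p q : Fin k → Bool} → (∀ i → p i ≡ true → q i ≡ true) →
               ∀ j → p j ≡ false → q j ≡ true → count p < count q
count-strict {p = p} {q} p⊆q j pj qj = ∑-mono-< (λ i → indicator-mono (p i) (q i) (p⊆q i)) j (new pj qj)
  where
  indicator-mono : ∀ a b → (a ≡ true → b ≡ true) → (if a then 1 else 0) ≤ (if b then 1 else 0)
  indicator-mono true  b h rewrite h refl = ≤-refl
  indicator-mono false _ _ = z≤n
  new : ∀ {a b} → a ≡ false → b ≡ true → (if a then 1 else 0) < (if b then 1 else 0)
  new refl refl = s≤s z≤n

anyB : ∀ {n} → (Fin n → Bool) → Bool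
anyB {zero}  _ = false
anyB {suc n} f = f zero ∨ anyB (λ i → f (suc i))

anyB-sound : ∀ {n} (f : Fin n → Bool) → anyB f ≡ true → ∃ λ i → f i ≡ true
anyB-sound {suc n} f h with f zero in eq
... | true  = zero , eq
... | false = let (i , r) = anyB-sound (λ i → f (suc i)) h in suc i , r

anyB-complete : ∀ {n} (f : Fin n → Bool) i → f i ≡ true → anyB f ≡ true
anyB-complete f zero    h = ∨-inl _ h
anyB-complete f (suc i) h = ∨-inr (f zero) (anyB-complete (λ j → f (suc j)) i h)

-- Deciding v ≡ a as a sum; unlike `with v ≟ a`, a case split on this does not
-- rewrite the occurrences of `does (v ≟ a)` hidden inside goals.
≡-or-≢ : ∀ {n} (v a : Fin n) → v ≡ a ⊎ v ≢ a
≡-or-≢ v a with v ≟ a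
... | yes eq = inj₁ eq
... | no ne  = inj₂ ne

module _ {H : Hypergraph} {sel : Fin (nE H) → Bool} where

  _++ₚ_ : ∀ {u v w} → PathIn H sel u v → PathIn H sel v w → PathIn H sel u w
  here               ++ₚ q = q
  step e r pu pw p   ++ₚ q = step e r pu pw (p ++ₚ q)

  reverseₚ : ∀ {u v} → PathIn H sel u v → PathIn H sel v u
  reverseₚ here               = here
  reverseₚ (step e r pu pw p) = reverseₚ p ++ₚ step e r pw pu here

  last-edge : ∀ {u v} → PathIn H sel u v → u ≢ v → ∃ λ e → sel e ≡ true × 0 < mult H e v
  last-edge here ne = ⊥-elim (ne refl)
  last-edge {v = v} (step {w = w} e r _ pw p) ne with w ≟ v
  ... | yes refl = e , r , pw
  ... | no w≢v   = last-edge p w≢v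

widen : ∀ {H sel sel' u v} → (∀ e → sel e ≡ true → sel' e ≡ true) → PathIn H sel u v → PathIn H sel' u v
widen _ here               = here
widen f (step e r pu pw p) = step e (f e r) pu pw (widen f p)

module Component (H : Hypergraph) (sel : Fin (nE H) → Bool) (s : Fin (nV H)) where

  VSet : Set
  VSet = Fin (nV H) → Bool

  meets : VSet → Fin (nE H) → Bool
  meets R e = anyB (λ x → R x ∧ isPos (mult H e x))

  meets-intro : ∀ R {e} x → R x ≡ true → 0 < mult H e x → meets R e ≡ true
  meets-intro R {e} x rx px = anyB-complete (λ x → R x ∧ isPos (mult H e x)) x (∧-intro rx (isPos-complete px))

  meets-elim : ∀ R e → meets R e ≡ true → ∃ λ x → R x ≡ true × 0 < mult H e x
  meets-elim R e h =
    let (x , h') = anyB-sound (λ x → R x ∧ isPos (mult H e x)) h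
        (rx , px) = ∧-elim (R x) _ h'
    in x , rx , isPos-sound px

  Closed : VSet → Set
  Closed R = ∀ e x y → sel e ≡ true → R x ≡ true → 0 < mult H e x → 0 < mult H e y → R y ≡ true

  closed-path : ∀ {R x y} → Closed R → R x ≡ true → PathIn H sel x y → R y ≡ true
  closed-path c rx here                 = rx
  closed-path c rx (step e r px pw p)   = closed-path c (c e _ _ r rx px pw) p

  expand : VSet → VSet
  expand R y = R y ∨ anyB (λ e → sel e ∧ (meets R e ∧ isPos (mult H e y)))

  expand-keeps : ∀ R y → R y ≡ true → expand R y ≡ true
  expand-keeps R y h = ∨-inl _ h

  expand-intro : ∀ R e x y → sel e ≡ true → R x ≡ true → 0 < mult H e x → 0 < mult H e y →
                 expand R y ≡ true
  expand-intro R e x y r rx px py =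
    ∨-inr (R y) (anyB-complete (λ e → sel e ∧ (meets R e ∧ isPos (mult H e y))) e
                  (∧-intro r (∧-intro (meets-intro R x rx px) (isPos-complete py))))

  expand-cases : ∀ R y → expand R y ≡ true →
                 R y ≡ true ⊎ ∃₂ λ e x → sel e ≡ true × R x ≡ true × 0 < mult H e x × 0 < mult H e y
  expand-cases R y h with ∨-elim (R y) _ h
  ... | inj₁ ry = inj₁ ry
  ... | inj₂ h' =
    let (e , he) = anyB-sound (λ e → sel e ∧ (meets R e ∧ isPos (mult H e y))) h'
        (r , hm) = ∧-elim (sel e) _ he
        (m , py) = ∧-elim (meets R e) _ hm
        (x , rx , px) = meets-elim R e m
    in inj₂ (e , x , r , rx , px , isPos-sound py)

  Stable : VSet → Set
  Stable R = ∀ y → expand R y ≡ true → R y ≡ true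

  closed⇒stable : ∀ R → Closed R → Stable R
  closed⇒stable R c y h with expand-cases R y h
  ... | inj₁ ry = ry
  ... | inj₂ (e , x , r , rx , px , py) = c e x y r rx px py

  stable⇒closed : ∀ R → Stable R → Closed R
  stable⇒closed R st e x y r rx px py = st y (expand-intro R e x y r rx px py)

  closed-expand : ∀ R → Closed R → Closed (expand R)
  closed-expand R c e x y r ex px py = expand-keeps R y (c e x y r (closed⇒stable R c x ex) px py)

  stable-or-new : ∀ R → Stable R ⊎ ∃ λ y → R y ≡ false × expand R y ≡ true
  stable-or-new R with anyB (λ y → expand R y ∧ not (R y)) in h
  ... | true =
    let (y , h') = anyB-sound (λ y → expand R y ∧ not (R y)) h
        (ey , nry) = ∧-elim (expand R y) _ h'
    in inj₂ (y , not-true nry , ey)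
  ... | false = inj₁ λ y ey → ¬-not λ ry → false≢true (trans (sym h)
                    (anyB-complete (λ y → expand R y ∧ not (R y)) y (∧-intro ey (cong not ry))))

  round : ℕ → VSet
  round zero y    = does (y ≟ s)
  round (suc k)   = expand (round k)

  round-source : ∀ k → round k s ≡ true
  round-source zero    = dec-true (s ≟ s) refl
  round-source (suc k) = expand-keeps _ s (round-source k)

  round-sound : ∀ k y → round k y ≡ true → PathIn H sel s y
  round-sound zero y h with y ≟ s
  ... | yes refl = here
  ... | no _     = ⊥-elim (false≢true h)
  round-sound (suc k) y h with expand-cases (round k) y h
  ... | inj₁ hy = round-sound k y hy
  ... | inj₂ (e , x , r , rx , px , py) = round-sound k x rx ++ₚ step e r px py here

  closed-or-large : ∀ k → Closed (round k) ⊎ suc k ≤ count (round k)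
  closed-or-large zero = inj₂ (count-pos (round zero) s (round-source zero))
  closed-or-large (suc k) with closed-or-large k
  ... | inj₁ c = inj₁ (closed-expand _ c)
  ... | inj₂ large with stable-or-new (round k)
  ...   | inj₁ st = inj₁ (closed-expand _ (stable⇒closed _ st))
  ...   | inj₂ (y , ry , ey) = inj₂ (≤-trans (s≤s large) (count-strict (expand-keeps _) y ry ey))

  component : VSet
  component = round (nV H)

  component-closed : Closed component
  component-closed with closed-or-large (nV H)
  ... | inj₁ c     = c
  ... | inj₂ large = ⊥-elim (1+n≰n (≤-trans large (count-≤ _)))

  component-source : component s ≡ true
  component-source = round-source (nV H)

  component-sound : ∀ y → component y ≡ true → PathIn H sel s y
  component-sound = round-sound (nV H)

module _ {G : Hypergraph} {α : Fin (nV G)} (W : Sub G) (S : Moved G α) where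

  moved-witness : 1 ≤ movedIn {G} {α} W S → ∃ λ e → es W e ≡ true × 1 ≤ count (S e)
  moved-witness m =
    let (e , p) = ∑-pos-witness (λ e → if es W e then count (S e) else 0) m
    in e , guard-pos (es W e) p

  kept-witness : movedIn {G} {α} W S < degSub W α → ∃ λ e → es W e ≡ true × count (S e) < mult G e α
  kept-witness lt =
    let (e , p) = ∑-<-witness (λ e → if es W e then count (S e) else 0)
                              (λ e → if es W e then mult G e α else 0) lt
    in e , guard-< (es W e) p

  moved-bound : ∀ e → es W e ≡ true → 1 ≤ count (S e) → 1 ≤ movedIn {G} {α} W S
  moved-bound e e∈W m = ≤-trans (≤-trans m (≤-reflexive (sym (guard-true e∈W))))
                                (∑-term (λ e → if es W e then count (S e) else 0) e)

  kept-bound : ∀ e → es W e ≡ true → count (S e) < mult G e α → movedIn {G} {α} W S < degSub W α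
  kept-bound e e∈W lt = ∑-mono-< (λ f → guard-≤ (es W f) (count-≤ (S f))) e (guard-<-intro e∈W lt)

module Deletion (G : Hypergraph) (α : Fin (nV G)) where

  G-α : Hypergraph
  G-α = record { nV = nV G ; nE = nE G ; mult = λ e v → if does (v ≟ α) then 0 else mult G e v }

  delete∈ : ∀ {e v} → v ≢ α → 0 < mult G e v → 0 < mult G-α e v
  delete∈ {e} {v} ne p with v ≟ α
  ... | yes eq = ⊥-elim (ne eq)
  ... | no _   = p

  delete∈⁻ : ∀ {e v} → 0 < mult G-α e v → v ≢ α × 0 < mult G e v
  delete∈⁻ {e} {v} p with v ≟ α
  ... | no ne = ne , p

  Reaches : Fin (nV G) → Fin (nE G) → Set
  Reaches u e = Σ (Fin (nV G)) λ v → 0 < mult G-α e v × PathIn G-α (λ _ → true) u v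

  Linked : Fin (nE G) → Fin (nE G) → Set
  Linked e e' = e ≡ e' ⊎ Σ (Fin (nV G)) λ u → 0 < mult G-α e u × Reaches u e'

-- The α-wing generated by an edge e₀ through α: its edges are those reachable
-- from e₀ without passing through α.  It is computed as a component of G − α
-- with an extra vertex (index zero) placed on e₀ only.

module WingThrough (G : Hypergraph) (α : Fin (nV G)) (e₀ : Fin (nE G)) (α∈e₀ : 0 < mult G e₀ α) where
  open Deletion G α

  pinMult : Fin (nE G) → Fin (suc (nV G)) → ℕ
  pinMult e zero    = if does (e ≟ e₀) then 1 else 0
  pinMult e (suc v) = mult G-α e v

  pinned : Hypergraph
  pinned = record { nV = suc (nV G) ; nE = nE G ; mult = pinMult }

  open Component pinned (λ _ → true) zero

  pin∈e₀ : 0 < pinMult e₀ zero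
  pin∈e₀ rewrite dec-true (e₀ ≟ e₀) refl = s≤s z≤n

  pin-only : ∀ e → 0 < pinMult e zero → e ≡ e₀
  pin-only e p with e ≟ e₀
  ... | yes eq = eq

  vsW : Fin (nV G) → Bool
  vsW v = does (v ≟ α) ∨ component (suc v)

  esW : Fin (nE G) → Bool
  esW = meets component

  vsW-other : ∀ {v} → v ≢ α → vsW v ≡ true → component (suc v) ≡ true
  vsW-other {v} ne h = subst (λ d → d ∨ component (suc v) ≡ true) (dec-false (v ≟ α) ne) h

  esW-closed : ∀ e v → esW e ≡ true → 0 < mult G e v → vsW v ≡ true
  esW-closed e v h p with ≡-or-≢ v α
  ... | inj₁ refl = ∨-inl _ (dec-true (α ≟ α) refl)
  ... | inj₂ ne =
    let (x , rx , px) = meets-elim component e h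
    in ∨-inr (does (v ≟ α)) (component-closed e x (suc v) refl rx px (delete∈ ne p))

  W : Sub G
  W = record { vs = vsW ; es = esW ; closed = esW-closed }

  e₀∈W : esW e₀ ≡ true
  e₀∈W = meets-intro component zero component-source pin∈e₀

  -- A path of the pinned graph from a component vertex back to the pin
  -- becomes a path in W to α (the last edge is e₀, which contains α).
  path-to-α : ∀ {a} → component (suc a) ≡ true →
              PathIn pinned (λ _ → true) (suc a) zero → PathIn G esW a α
  path-to-α {a} ra (step {w = zero} e _ pa pz _) with pin-only e pz
  ... | refl = step e₀ (meets-intro component (suc a) ra pa) (proj₂ (delete∈⁻ pa)) α∈e₀ here
  path-to-α {a} ra (step {w = suc b} e r pa pb p) =
    step e (meets-intro component (suc a) ra pa) (proj₂ (delete∈⁻ pa)) (proj₂ (delete∈⁻ pb))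
      (path-to-α (component-closed e (suc a) (suc b) r ra pa pb) p)

  vertex-to-α : ∀ u → vsW u ≡ true → PathIn G esW u α
  vertex-to-α u h with ≡-or-≢ u α
  ... | inj₁ refl = here
  ... | inj₂ ne   = let ru = vsW-other ne h in path-to-α ru (reverseₚ (component-sound (suc u) ru))

  W-connected : ConnectedSub W
  W-connected u v hu hv = vertex-to-α u hu ++ₚ reverseₚ (vertex-to-α v hv)

  -- In a splitting W = I ∪ J at α with e₀ ∈ I, every component vertex lies
  -- in I and every edge of W lies in I, so J has no edges.
  module Splitting (I J : Sub G) (edges : ∀ e → (es I e ∨ es J e) ≡ esW e)
                   (meet : ∀ v → (vs I v ∧ vs J v) ≡ does (v ≟ α))
                   (disjoint : ∀ e → (es I e ∧ es J e) ≡ false) (e₀∈I : es I e₀ ≡ true) where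

    InI : Fin (suc (nV G)) → Set
    InI zero    = ⊤
    InI (suc y) = vs I y ≡ true

    shared-only-α : ∀ y → y ≢ α → vs I y ≡ true → vs J y ≡ true → ⊥
    shared-only-α y ne iy jy =
      false≢true (trans (sym (dec-false (y ≟ α) ne)) (trans (sym (meet y)) (∧-intro iy jy)))

    -- An edge through a component vertex in I lies in I: were it in J, its
    -- vertex other than α would be shared by I and J.
    edge-in-I : ∀ e z → component z ≡ true → InI z → 0 < pinMult e z → es I e ≡ true
    edge-in-I e zero _ _ pz with pin-only e pz
    ... | refl = e₀∈I
    edge-in-I e (suc y) rz iy py with es I e in ei
    ... | true  = refl
    ... | false =
      let (ne , p) = delete∈⁻ py
          ej = trans (cong (_∨ es J e) (sym ei)) (trans (edges e) (meets-intro component (suc y) rz py))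
      in ⊥-elim (shared-only-α y ne iy (closed J e y ej p))

    next-in-I : ∀ e w → es I e ≡ true → 0 < pinMult e w → InI w
    next-in-I e zero    _  _  = tt
    next-in-I e (suc b) ei pw = closed I e b ei (proj₂ (delete∈⁻ pw))

    along : ∀ {z t} → component z ≡ true → InI z → PathIn pinned (λ _ → true) z t → InI t
    along rz iz here = iz
    along {z} rz iz (step {w = w} e r pz pw p) =
      along (component-closed e z w r rz pz pw) (next-in-I e w (edge-in-I e z rz iz pz) pw) p

    J-trivial : ¬ NonTrivial J
    J-trivial (f , fj) with meets-elim component f (trans (sym (edges f)) (∨-inr (es I f) fj))
    ... | zero , _ , pf with pin-only f pf
    ...   | refl = false≢true (trans (sym (disjoint e₀)) (∧-intro e₀∈I fj))
    J-trivial (f , fj) | suc y , ry , pf =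
      let (ne , p) = delete∈⁻ pf
      in shared-only-α y ne (along component-source tt (component-sound (suc y) ry)) (closed J f y fj p)

  not-cut : ¬ CutVertex α W
  not-cut (I , J , ntI , ntJ , _ , edges , meet , disjoint) with ∨-elim (es I e₀) _ (trans (edges e₀) e₀∈W)
  ... | inj₁ e₀∈I = Splitting.J-trivial I J edges meet disjoint e₀∈I ntJ
  ... | inj₂ e₀∈J = Splitting.J-trivial J I (λ e → trans (∨-comm (es J e) (es I e)) (edges e))
                      (λ v → trans (∧-comm (vs J v) (vs I v)) (meet v))
                      (λ e → trans (∧-comm (es J e) (es I e)) (disjoint e)) e₀∈J ntI

  isolated : ∀ e v → esW e ≡ false → vsW v ≡ true → v ≢ α → mult G e v ≡ 0
  isolated e v ef hv ne with mult G e v in mv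
  ... | zero  = refl
  ... | suc _ = ⊥-elim (false≢true (trans (sym ef)
                  (meets-intro component (suc v) (vsW-other ne hv) (delete∈ ne (subst (0 <_) (sym mv) (s≤s z≤n))))))

  lift : ∀ {u v} → PathIn G-α (λ _ → true) u v → PathIn pinned (λ _ → true) (suc u) (suc v)
  lift here               = here
  lift (step e r pu pw p) = step e r pu pw (lift p)

  linked∈W : ∀ e → Linked e₀ e → esW e ≡ true
  linked∈W e (inj₁ refl) = e₀∈W
  linked∈W e (inj₂ (u , pu , v , pv , q)) =
    meets-intro component (suc v)
      (closed-path component-closed component-source (step e₀ refl pin∈e₀ pu (lift q))) pv

wing-through : (G : Hypergraph) (α : Fin (nV G)) (e₀ : Fin (nE G)) → 0 < mult G e₀ α →
               Σ (Sub G) λ W → Wing G α W × (∀ e → Deletion.Linked G α e₀ e → es W e ≡ true)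
wing-through G α e₀ α∈e₀ = W , ((e₀ , e₀∈W) , W-connected , not-cut , isolated) , linked∈W
  where open WingThrough G α e₀ α∈e₀

module Detachment (G : Hypergraph) (α : Fin (nV G)) (S : Moved G α) where
  open Deletion G α

  G' : Hypergraph
  G' = detach G α S

  Keeps Moves : Fin (nE G) → Set
  Keeps e = count (S e) < mult G e α
  Moves e = 1 ≤ count (S e)

  keeps⇒α∈ : ∀ e → Keeps e → 0 < mult G' e (suc α)
  keeps⇒α∈ e k rewrite dec-true (α ≟ α) refl = m<n⇒0<n∸m k

  moves⇒α∈ : ∀ e → Moves e → 0 < mult G e α
  moves⇒α∈ e m = <-≤-trans m (count-≤ (S e))

  α∈⇒keeps : ∀ e → 0 < mult G' e (suc α) → Keeps e
  α∈⇒keeps e p rewrite dec-true (α ≟ α) refl = m∸n≢0⇒n<m (n>0⇒n≢0 p)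

  other-mult : ∀ e {u} → u ≢ α → mult G' e (suc u) ≡ mult G e u
  other-mult e {u} ne rewrite dec-false (u ≟ α) ne = refl

  lift∈ : ∀ {e u} → u ≢ α → 0 < mult G e u → 0 < mult G' e (suc u)
  lift∈ {e} ne = subst (0 <_) (sym (other-mult e ne))

  lower∈ : ∀ {e u} → u ≢ α → 0 < mult G' e (suc u) → 0 < mult G e u
  lower∈ {e} ne = subst (0 <_) (other-mult e ne)

  -- (⇐)  If α is not a cut vertex of W and W has edges e₁ moving and e₂
  -- keeping a hinge at α, then the component of α in G' ∩ W contains β:
  -- otherwise the edges of W meeting it (I) and the rest (J) cut W at α.

  module Separation (W : Sub G) (not-cut : ¬ CutVertex α W)
                    (e₁ : Fin (nE G)) (e₁∈W : es W e₁ ≡ true) (moves : Moves e₁)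
                    (e₂ : Fin (nE G)) (e₂∈W : es W e₂ ≡ true) (keeps : Keeps e₂) where
    open Component G' (es W) (suc α)

    R : Fin (nV G) → Bool
    R v = component (suc v)

    α∈W : vs W α ≡ true
    α∈W = closed W e₂ α e₂∈W (≤-trans (s≤s z≤n) keeps)

    R⊆W : ∀ v → v ≢ α → R v ≡ true → vs W v ≡ true
    R⊆W v ne h =
      let (e , r , p) = last-edge (component-sound (suc v) h) (λ { refl → ne refl })
      in closed W e v r (lower∈ ne p)

    vsI vsJ : Fin (nV G) → Bool
    vsI v = does (v ≟ α) ∨ R v
    vsJ v = does (v ≟ α) ∨ (vs W v ∧ not (R v))

    esI esJ : Fin (nE G) → Bool
    esI e = es W e ∧ meets component e
    esJ e = es W e ∧ not (meets component e)

    I-closed : ∀ e v → esI e ≡ true → 0 < mult G e v → vsI v ≡ true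
    I-closed e v h p with ≡-or-≢ v α
    ... | inj₁ refl = ∨-inl _ (dec-true (α ≟ α) refl)
    ... | inj₂ ne =
      let (ew , m) = ∧-elim (es W e) _ h
          (x , rx , px) = meets-elim component e m
      in ∨-inr (does (v ≟ α)) (component-closed e x (suc v) ew rx px (lift∈ ne p))

    J-closed : ∀ e v → esJ e ≡ true → 0 < mult G e v → vsJ v ≡ true
    J-closed e v h p with ≡-or-≢ v α
    ... | inj₁ refl = ∨-inl _ (dec-true (α ≟ α) refl)
    ... | inj₂ ne =
      let (ew , notMeets) = ∧-elim (es W e) _ h
          outside = ¬-not λ rv → false≢true (trans (sym (not-true notMeets))
                                   (meets-intro component (suc v) rv (lift∈ ne p)))
      in ∨-inr (does (v ≟ α)) (∧-intro (closed W e v ew p) (cong not outside))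

    I J : Sub G
    I = record { vs = vsI ; es = esI ; closed = I-closed }
    J = record { vs = vsJ ; es = esJ ; closed = J-closed }

    split-∨ : ∀ a b → ((a ∧ b) ∨ (a ∧ not b)) ≡ a
    split-∨ true true  = refl
    split-∨ true false = refl
    split-∨ false _    = refl

    split-∧ : ∀ a b → ((a ∧ b) ∧ (a ∧ not b)) ≡ false
    split-∧ true true  = refl
    split-∧ true false = refl
    split-∧ false _    = refl

    vertex-union : ∀ d r w → (d ≡ true → w ≡ true) → (r ≡ true → w ≡ true) →
                   ((d ∨ r) ∨ (d ∨ (w ∧ not r))) ≡ w
    vertex-union true  _     _     hd _  = sym (hd refl)
    vertex-union false true  _     _  hr = sym (hr refl)
    vertex-union false false true  _  _  = refl
    vertex-union false false false _  _  = refl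

    vertex-meet : ∀ d r w → ((d ∨ r) ∧ (d ∨ (w ∧ not r))) ≡ d
    vertex-meet true  _     _     = refl
    vertex-meet false true  true  = refl
    vertex-meet false true  false = refl
    vertex-meet false false _     = refl

    α-only : ∀ v → does (v ≟ α) ≡ true → vs W v ≡ true
    α-only v h with v ≟ α
    ... | yes refl = α∈W

    R-only : ∀ v → R v ≡ true → vs W v ≡ true
    R-only v h with ≡-or-≢ v α
    ... | inj₁ refl = α∈W
    ... | inj₂ ne   = R⊆W v ne h

    I-nontrivial : NonTrivial I
    I-nontrivial = e₂ , ∧-intro e₂∈W (meets-intro component (suc α) component-source (keeps⇒α∈ e₂ keeps))

    J-nontrivial : component zero ≡ false → NonTrivial J
    J-nontrivial β∉ = e₁ , ∧-intro e₁∈W (cong not avoids)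
      where
      avoids : meets component e₁ ≡ false
      avoids = ¬-not λ m → let (x , rx , px) = meets-elim component e₁ m
                          in false≢true (trans (sym β∉) (component-closed e₁ x zero e₁∈W rx px moves))

    β-reached : component zero ≡ true
    β-reached = ¬-not λ β∉ →
      not-cut (I , J , I-nontrivial , J-nontrivial β∉ ,
               (λ v → vertex-union (does (v ≟ α)) (R v) (vs W v) (α-only v) (R-only v)) ,
               (λ e → split-∨ (es W e) (meets component e)) ,
               (λ v → vertex-meet (does (v ≟ α)) (R v) (vs W v)) ,
               (λ e → split-∧ (es W e) (meets component e)))

  β-reachable : (W : Sub G) → ¬ CutVertex α W → (e₁ : Fin (nE G)) → es W e₁ ≡ true → Moves e₁ →
                (e₂ : Fin (nE G)) → es W e₂ ≡ true → Keeps e₂ → PathIn G' (λ _ → true) (suc α) zero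
  β-reachable W nc e₁ e₁∈W m e₂ e₂∈W k =
    widen (λ _ _ → refl) (component-sound zero β-reached)
    where open Separation W nc e₁ e₁∈W m e₂ e₂∈W k
          open Component G' (es W) (suc α) using (component-sound)

  -- A path of G ending at α lifts to a path of G' ending at α, detouring
  -- through β when its last edge has all α-hinges moved.
  module _ (α→β : PathIn G' (λ _ → true) (suc α) zero) where

    lift-to-α : ∀ {u} → PathIn G (λ _ → true) u α → PathIn G' (λ _ → true) (suc u) (suc α)
    lift-to-α here = here
    lift-to-α (step {u} {w} e r pu pw p) with u ≟ α
    ... | yes refl = here
    ... | no u≢α with w ≟ α
    ...   | no w≢α   = step e refl (lift∈ u≢α pu) (lift∈ w≢α pw) (lift-to-α p)
    ...   | yes refl with count (S e) <? mult G e α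
    ...     | yes k  = step e refl (lift∈ u≢α pu) (keeps⇒α∈ e k) here
    ...     | no ¬k  = step e refl (lift∈ u≢α pu) (<-≤-trans pw (≮⇒≥ ¬k)) (reverseₚ α→β)

    connected-if-joined : Connected G → Connected G'
    connected-if-joined cG x y = to-α x ++ₚ reverseₚ (to-α y)
      where
      to-α : ∀ y → PathIn G' (λ _ → true) y (suc α)
      to-α zero    = reverseₚ α→β
      to-α (suc u) = lift-to-α (cG u α)

  -- (⇒)  A path from β to α in G' contains an edge moving a hinge that is
  -- α-linked to an edge keeping a hinge.

  record Crossing : Set where
    field
      from   : Fin (nE G)
      moves  : Moves from
      to     : Fin (nE G)
      keeps  : Keeps to
      linked : Linked from to

  -- What a path from x to α in G' reveals, scanning it backwards.
  data Approach : Fin (suc (nV G)) → Set where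
    crossed : ∀ {x} → Crossing → Approach x
    atα     : Approach (suc α)
    near    : ∀ {u} → u ≢ α → (e : Fin (nE G)) → Keeps e → Reaches u e → Approach (suc u)

  approach-step : ∀ {x w} (e : Fin (nE G)) → 0 < mult G' e x → 0 < mult G' e w → Approach w → Approach x
  approach-step e _ _ (crossed c) = crossed c
  approach-step {zero} e px pw atα =
    crossed (record { from = e ; moves = px ; to = e ; keeps = α∈⇒keeps e pw ; linked = inj₁ refl })
  approach-step {suc u} e px pw atα with ≡-or-≢ u α
  ... | inj₁ refl = atα
  ... | inj₂ ne   = near ne e (α∈⇒keeps e pw) (u , delete∈ ne (lower∈ ne px) , here)
  approach-step {zero} e px pw (near {u'} ne' f k reach) =
    crossed (record { from = e ; moves = px ; to = f ; keeps = k
                    ; linked = inj₂ (u' , delete∈ ne' (lower∈ ne' pw) , reach) })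
  approach-step {suc u} e px pw (near {u'} ne' f k (v , pv , q)) with ≡-or-≢ u α
  ... | inj₁ refl = atα
  ... | inj₂ ne   =
    near ne f k (v , pv , step e refl (delete∈ ne (lower∈ ne px)) (delete∈ ne' (lower∈ ne' pw)) q)

  approach : ∀ {x} → PathIn G' (λ _ → true) x (suc α) → Approach x
  approach here               = atα
  approach (step e _ px pw p) = approach-step e px pw (approach p)

  crossing : PathIn G' (λ _ → true) zero (suc α) → Crossing
  crossing p with approach p
  ... | crossed c = c

  GoodWing : Set
  GoodWing = Σ (Sub G) (λ W → Wing G α W × 2 ≤ degSub W α ×
               1 ≤ movedIn {G} {α} W S × movedIn {G} {α} W S < degSub W α)

  -- The α-wing generated by the moving edge contains the keeping edge too.
  wing-from-crossing : Crossing → GoodWing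
  wing-from-crossing c with wing-through G α (Crossing.from c) (moves⇒α∈ (Crossing.from c) (Crossing.moves c))
  ... | W , wing , in-W = W , wing , ≤-trans (s≤s m) lt , m , lt
    where
    open Crossing c
    m : 1 ≤ movedIn {G} {α} W S
    m = moved-bound W S from (in-W from (inj₁ refl)) moves
    lt : movedIn {G} {α} W S < degSub W α
    lt = kept-bound W S to (in-W to linked) keeps

lemma2p1 : (G : Hypergraph) → Connected G → (α : Fin (nV G)) → (S : Moved G α) →
    Connected (detach G α S) ⇔
    Σ (Sub G) (λ W → Wing G α W × 2 ≤ degSub W α ×
    1 ≤ movedIn {G} {α} W S × movedIn {G} {α} W S < degSub W α)
lemma2p1 G cG α S = mk⇔ forward backward
  where
  open Detachment G α S

  forward : Connected G' → GoodWing
  forward cG' = wing-from-crossing (crossing (cG' zero (suc α)))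

  backward : GoodWing → Connected G'
  backward (W , (_ , _ , not-cut , _) , _ , m , lt) =
    let (e₁ , e₁∈W , moves) = moved-witness W S m
        (e₂ , e₂∈W , keeps) = kept-witness W S lt
    in connected-if-joined (β-reachable W not-cut e₁ e₁∈W moves e₂ e₂∈W keeps) cG
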